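{- Let $C_n$ be the cycle on $n\ge 4$ vertices. Then $\mathrm{Z}_t(C_n)=4$.
   Context: Zero forcing: given a set $B\subseteq V(G)$ of initially blue vertices (all others white), the color change rule allows a blue vertex $b$ to turn a white vertex $w$ blue if $w$ is the unique white neighbor of $b$. $B$ is a zero forcing set if repeated application of this rule eventually turns all of $V(G)$ blue. A set $B\subseteq V(G)$ with $|B|=m\ge 1$ is a fault tolerant zero forcing set if every subset $F\subseteq B$ with $|F|=m-1$ is a zero forcing set of $G$. $\mathrm{Z}_t(G)$ is the minimum cardinality of a fault tolerant zero forcing set of $G$. -}

module Defs where

open import Data.Nat using (ℕ; zero; suc; _+_; _∸_; _≤_)
open import Data.Fin using (Fin; toℕ)
open import Data.Fin.Subset using (Subset; _∈_; _⊆_; ∣_∣)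
open import Data.Sum using (_⊎_)
open import Data.Product using (_×_; ∃)
open import Relation.Binary.PropositionalEquality using (_≡_; _≢_)

Graph : ℕ → Set₁
Graph n = Fin n → Fin n → Set

-- The cycle C_n on vertices 0,1,…,n-1: i ~ j iff j ≡ i+1 (mod n) or i ≡ j+1 (mod n).
Succ : (n : ℕ) → Fin n → Fin n → Set
Succ n i j = (toℕ j ≡ Data.Nat.suc (toℕ i)) ⊎ ((Data.Nat.suc (toℕ i) ≡ n) × (toℕ j ≡ 0))

Cycle : (n : ℕ) → Graph n
Cycle n i j = Succ n i j ⊎ Succ n j i

data Blue {n : ℕ} (G : Graph n) (B : Subset n) : Fin n → Set where
  initial : ∀ {v} → v ∈ B → Blue G B v
  force   : ∀ {b w} → Blue G B b → G b w
          → (∀ u → G b u → u ≢ w → Blue G B u)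
          → Blue G B w

IsZeroForcingSet : {n : ℕ} → Graph n → Subset n → Set
IsZeroForcingSet G B = ∀ v → Blue G B v

IsFaultTolerantZFS : {n : ℕ} → Graph n → Subset n → Set
IsFaultTolerantZFS G B =
  (1 ≤ ∣ B ∣) × (∀ F → F ⊆ B → ∣ F ∣ ≡ ∣ B ∣ ∸ 1 → IsZeroForcingSet G F)

FaultTolerantZFNumberIs : {n : ℕ} → Graph n → ℕ → Set
FaultTolerantZFNumberIs G k =
  (∃ λ B → IsFaultTolerantZFS G B × ∣ B ∣ ≡ k)
  × (∀ B → IsFaultTolerantZFS G B → k ≤ ∣ B ∣)

-- Upper bound: among any three of the vertices 0, 1, 2, 3 two are consecutive, and two adjacent
-- blue vertices of a cycle force the whole cycle around in both directions.
-- Lower bound: in a graph without leaves a forcing step b → w needs a second blue neighbour of b,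
-- so every zero forcing set of C_n contains an edge.  If B is fault tolerant, each B - x
-- therefore contains an edge; with |B| ≤ 3 these edges would form a triangle, which C_n
-- (n ≥ 4) does not have.
module Submission where

open import Defs
open import Data.Nat using (ℕ; zero; suc; _+_; _∸_; _≤_; _<_; z≤n; s≤s; _≤?_; _<?_)
open import Data.Nat.Properties
  using ( suc-injective; 0≢1+n; <-irrefl; <⇒≱; ≮⇒≥; ≰⇒>; ≤-antisym; <⇒≤; ≤-trans; <-trans; n<1+n
        ; m∸n+n≡m; n≤0⇒n≡0; +-identityʳ; ≤-reflexive)
open import Data.Fin as Fin using (Fin; toℕ; fromℕ<; fromℕ; inject₁; _≟_)
open import Data.Fin.Properties using (toℕ-injective; toℕ<n; toℕ-fromℕ<; toℕ-fromℕ; toℕ-inject₁)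
open import Data.Fin.Subset using (Subset; _∈_; _⊆_; ∣_∣; _-_; inside; outside; Nonempty)
open import Data.Fin.Subset using () renaming (⊥ to ∅)
open import Data.Fin.Subset.Properties
  using ( p─q⊆p; x∈p∧x≢y⇒x∈p-y; x∈p⇒∣p-x∣<∣p∣; p─⊥≡p; drop-∷-⊆; p⊆q⇒∣p∣≤∣q∣; ∣⊥∣≡0
        ; nonempty?; Empty-unique)
open import Data.Vec using (_∷_; here; there)
open import Data.Sum using (_⊎_; inj₁; inj₂; swap)
open import Data.Product using (_×_; _,_; ∃; ∃₂; proj₁)
open import Data.Empty using (⊥; ⊥-elim)
open import Function using (_∘_)
open import Relation.Binary.Definitions using (Symmetric)
open import Relation.Nullary using (¬_; yes; no; contradiction)
open import Relation.Nullary.Decidable using (decidable-stable)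
open import Relation.Binary.PropositionalEquality using (_≡_; _≢_; refl; sym; trans; cong; subst)

private
  variable
    k n j m : ℕ

HasEdgeIn : Graph n → Subset n → Set
HasEdgeIn G F = ∃₂ λ u v → u ∈ F × v ∈ F × G u v

Leafless : Graph n → Set
Leafless G = ∀ {b w} → G b w → ∃ λ u → G b u × u ≢ w

-- Degenerate triangles with repeated vertices count, so a triangle-free graph has no loops.
TriangleFree : Graph n → Set
TriangleFree G = ∀ {u v w} → G u v → G v w → G w u → ⊥

module _ {G : Graph n} {F : Subset n} where

  blue⇒∈⊎HasEdgeIn : Leafless G → ∀ {v} → Blue G F v → v ∈ F ⊎ HasEdgeIn G F
  blue⇒∈⊎HasEdgeIn leafless (initial v∈F) = inj₁ v∈F
  blue⇒∈⊎HasEdgeIn leafless (force {b} {w} blue-b b~w others) with leafless b~w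
  ... | u , b~u , u≢w
    with blue⇒∈⊎HasEdgeIn leafless blue-b | blue⇒∈⊎HasEdgeIn leafless (others u b~u u≢w)
  ...   | inj₂ edge | _         = inj₂ edge
  ...   | inj₁ _    | inj₂ edge = inj₂ edge
  ...   | inj₁ b∈F  | inj₁ u∈F  = inj₂ (b , u , b∈F , u∈F , b~u)

  zfs⇒HasEdgeIn : Leafless G → ∀ {x y} → G x y → IsZeroForcingSet G F → HasEdgeIn G F
  zfs⇒HasEdgeIn leafless {x} {y} x~y zfs
    with blue⇒∈⊎HasEdgeIn leafless (zfs x) | blue⇒∈⊎HasEdgeIn leafless (zfs y)
  ... | inj₂ edge | _         = edge
  ... | inj₁ _    | inj₂ edge = edge
  ... | inj₁ x∈F  | inj₁ y∈F  = x , y , x∈F , y∈F , x~y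

x∈p-y⇒x≢y : ∀ {p : Subset n} {x y} → x ∈ p - y → x ≢ y
x∈p-y⇒x≢y {p = _ ∷ _} {Fin.zero}  ()        refl
x∈p-y⇒x≢y {p = _ ∷ p} {Fin.suc x} (there m) refl = x∈p-y⇒x≢y {p = p} m refl

x∈p⇒suc∣p-x∣≡∣p∣ : ∀ {p : Subset n} {x} → x ∈ p → suc ∣ p - x ∣ ≡ ∣ p ∣
x∈p⇒suc∣p-x∣≡∣p∣ {p = inside ∷ p}  here      = cong (suc ∘ ∣_∣) (p─⊥≡p p)
x∈p⇒suc∣p-x∣≡∣p∣ {p = inside ∷ _}  (there m) = cong suc (x∈p⇒suc∣p-x∣≡∣p∣ m)
x∈p⇒suc∣p-x∣≡∣p∣ {p = outside ∷ _} (there m) = x∈p⇒suc∣p-x∣≡∣p∣ m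

x∈p∧m≤∣p-x∣⇒m<∣p∣ : ∀ {p : Subset n} {x} → x ∈ p → m ≤ ∣ p - x ∣ → m < ∣ p ∣
x∈p∧m≤∣p-x∣⇒m<∣p∣ x∈p m≤ = ≤-trans (s≤s m≤) (x∈p⇒∣p-x∣<∣p∣ x∈p)

∣p∣<4⇒exhausted-by-three : ∀ {p : Subset n} {x y z w} → ∣ p ∣ < 4 →
  x ∈ p → y ∈ p - x → z ∈ p - x - y → w ∈ p → w ≡ x ⊎ w ≡ y ⊎ w ≡ z
∣p∣<4⇒exhausted-by-three {x = x} {y} {z} {w} ∣p∣<4 x∈p y∈ z∈ w∈p with w ≟ x | w ≟ y | w ≟ z
... | yes w≡x | _       | _       = inj₁ w≡x
... | no _    | yes w≡y | _       = inj₂ (inj₁ w≡y)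
... | no _    | no _    | yes w≡z = inj₂ (inj₂ w≡z)
... | no w≢x  | no w≢y  | no w≢z  = ⊥-elim (<⇒≱ ∣p∣<4 4≤∣p∣)
  where
  w∈ = x∈p∧x≢y⇒x∈p-y (x∈p∧x≢y⇒x∈p-y (x∈p∧x≢y⇒x∈p-y w∈p w≢x) w≢y) w≢z
  grow = x∈p∧m≤∣p-x∣⇒m<∣p∣
  4≤∣p∣ = grow x∈p (grow y∈ (grow z∈ (grow w∈ z≤n)))

1≤∣p∣⇒Nonempty : ∀ {p : Subset n} → 1 ≤ ∣ p ∣ → Nonempty p
1≤∣p∣⇒Nonempty {n} {p} 1≤∣p∣ = decidable-stable (nonempty? p) λ empty →
  contradiction (subst (1 ≤_) (trans (cong ∣_∣ (Empty-unique empty)) (∣⊥∣≡0 n)) 1≤∣p∣) λ ()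

fault-tolerant⇒zfs-without : ∀ {G : Graph n} {B x} →
  IsFaultTolerantZFS G B → x ∈ B → IsZeroForcingSet G (B - x)
fault-tolerant⇒zfs-without {B = B} {x} (_ , tolerant) x∈B =
  tolerant (B - x) (p─q⊆p B _) (cong (_∸ 1) (x∈p⇒suc∣p-x∣≡∣p∣ x∈B))

module _ {G : Graph n} (G-sym : Symmetric G) (triangle-free : TriangleFree G) where

  private
    loop-free : ∀ {v} → ¬ G v v
    loop-free v~v = triangle-free v~v v~v v~v

  edge-within-pair : ∀ {F : Subset n} {p q} →
    (∀ {v} → v ∈ F → v ≡ p ⊎ v ≡ q) → HasEdgeIn G F → G p q
  edge-within-pair within (u , v , u∈F , v∈F , u~v) with within u∈F | within v∈F
  ... | inj₁ refl | inj₁ refl = ⊥-elim (loop-free u~v)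
  ... | inj₁ refl | inj₂ refl = u~v
  ... | inj₂ refl | inj₁ refl = G-sym u~v
  ... | inj₂ refl | inj₂ refl = ⊥-elim (loop-free u~v)

  edge-without-each⇒4≤∣B∣ : ∀ {B : Subset n} →
    Nonempty B → (∀ {x} → x ∈ B → HasEdgeIn G (B - x)) → 4 ≤ ∣ B ∣
  edge-without-each⇒4≤∣B∣ {B} (x , x∈B) edge-without with edge-without x∈B
  ... | y , z , y∈B-x , z∈B-x , y~z = ≮⇒≥ λ ∣B∣<4 →
    triangle-free (edge-within-pair (others-than-z ∣B∣<4) (edge-without z∈B)) y~z
                  (G-sym (edge-within-pair (others-than-y ∣B∣<4) (edge-without y∈B)))
    where
    y∈B = p─q⊆p B _ y∈B-x
    z∈B = p─q⊆p B _ z∈B-x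
    z∈B-x-y = x∈p∧x≢y⇒x∈p-y z∈B-x λ { refl → loop-free y~z }

    members : ∣ B ∣ < 4 → ∀ {v} → v ∈ B → v ≡ x ⊎ v ≡ y ⊎ v ≡ z
    members ∣B∣<4 = ∣p∣<4⇒exhausted-by-three ∣B∣<4 x∈B y∈B-x z∈B-x-y

    others-than-y : ∣ B ∣ < 4 → ∀ {v} → v ∈ B - y → v ≡ x ⊎ v ≡ z
    others-than-y ∣B∣<4 v∈ with members ∣B∣<4 (p─q⊆p B _ v∈)
    ... | inj₁ v≡x        = inj₁ v≡x
    ... | inj₂ (inj₁ v≡y) = contradiction v≡y (x∈p-y⇒x≢y {p = B} v∈)
    ... | inj₂ (inj₂ v≡z) = inj₂ v≡z

    others-than-z : ∣ B ∣ < 4 → ∀ {v} → v ∈ B - z → v ≡ x ⊎ v ≡ y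
    others-than-z ∣B∣<4 v∈ with members ∣B∣<4 (p─q⊆p B _ v∈)
    ... | inj₁ v≡x        = inj₁ v≡x
    ... | inj₂ (inj₁ v≡y) = inj₂ v≡y
    ... | inj₂ (inj₂ v≡z) = contradiction v≡z (x∈p-y⇒x≢y {p = B} v∈)

-- `Succ n i j` unfolds to `Succℕ n (toℕ i) (toℕ j)`, where the equations can be matched on.
Succℕ : ℕ → ℕ → ℕ → Set
Succℕ n a b = b ≡ suc a ⊎ (suc a ≡ n × b ≡ 0)

Succℕ-functional : ∀ {a b c} → b < n → c < n → Succℕ n a b → Succℕ n a c → b ≡ c
Succℕ-functional _   _   (inj₁ refl)       (inj₁ refl)       = refl
Succℕ-functional b<n _   (inj₁ refl)       (inj₂ (a+1≡n , _)) = ⊥-elim (<-irrefl a+1≡n b<n)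
Succℕ-functional _   c<n (inj₂ (a+1≡n , _)) (inj₁ refl)       = ⊥-elim (<-irrefl a+1≡n c<n)
Succℕ-functional _   _   (inj₂ (_ , refl)) (inj₂ (_ , refl)) = refl

Succℕ-injective : ∀ {a b c} → Succℕ n a c → Succℕ n b c → a ≡ b
Succℕ-injective (inj₁ refl)          (inj₁ c≡b+1)         = suc-injective c≡b+1
Succℕ-injective (inj₁ refl)          (inj₂ (_ , ()))
Succℕ-injective (inj₂ (_ , refl))    (inj₁ ())
Succℕ-injective (inj₂ (a+1≡n , _))   (inj₂ (b+1≡n , _))   = suc-injective (trans a+1≡n (sym b+1≡n))

Succℕ⇒≢ : ∀ {a b} → Succℕ (2 + k) a b → a ≢ b
Succℕ⇒≢ (inj₁ ())             refl
Succℕ⇒≢ (inj₂ (() , refl))    refl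

Succℕ-asym : ∀ {a b} → Succℕ (3 + k) a b → ¬ Succℕ (3 + k) b a
Succℕ-asym (inj₁ refl)       (inj₁ ())
Succℕ-asym (inj₁ refl)       (inj₂ (() , refl))
Succℕ-asym (inj₂ (() , refl)) (inj₁ refl)
Succℕ-asym (inj₂ (_ , refl)) (inj₂ (() , refl))

Succℕ-no-3-cycle : ∀ {a b c} → Succℕ (4 + k) a b → Succℕ (4 + k) b c → ¬ Succℕ (4 + k) c a
Succℕ-no-3-cycle (inj₁ refl)       (inj₁ refl)       (inj₁ ())
Succℕ-no-3-cycle (inj₁ refl)       (inj₁ refl)       (inj₂ (() , refl))
Succℕ-no-3-cycle (inj₁ refl)       (inj₂ (() , refl)) (inj₁ refl)
Succℕ-no-3-cycle (inj₁ refl)       (inj₂ (() , refl)) (inj₂ (_ , refl))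
Succℕ-no-3-cycle (inj₂ (() , refl)) (inj₁ refl)       (inj₁ refl)
Succℕ-no-3-cycle (inj₂ (_ , refl)) (inj₁ refl)       (inj₂ (() , refl))
Succℕ-no-3-cycle (inj₂ (_ , refl)) (inj₂ (() , refl)) _

Cycle-sym : Symmetric (Cycle n)
Cycle-sym = swap

Cycle-triangle-free : TriangleFree (Cycle (4 + k))
Cycle-triangle-free {u = u} {v} {w} = triangle
  where
  functional : ∀ {x y z : Fin (4 + k)} → Succ _ x y → Succ _ x z → toℕ y ≡ toℕ z
  functional = Succℕ-functional (toℕ<n _) (toℕ<n _)
  triangle : Cycle _ u v → Cycle _ v w → Cycle _ w u → ⊥
  triangle (inj₁ u→v) (inj₁ v→w) (inj₁ w→u) = Succℕ-no-3-cycle u→v v→w w→u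
  triangle (inj₂ v→u) (inj₂ w→v) (inj₂ u→w) = Succℕ-no-3-cycle u→w w→v v→u
  triangle (inj₁ u→v) (inj₁ v→w) (inj₂ u→w) = Succℕ⇒≢ v→w (functional u→v u→w)
  triangle (inj₁ u→v) (inj₂ w→v) (inj₁ w→u) = Succℕ⇒≢ w→u (Succℕ-injective w→v u→v)
  triangle (inj₂ v→u) (inj₁ v→w) (inj₁ w→u) = Succℕ⇒≢ w→u (sym (functional v→u v→w))
  triangle (inj₁ u→v) (inj₂ w→v) (inj₂ u→w) = Succℕ⇒≢ u→w (Succℕ-injective u→v w→v)
  triangle (inj₂ v→u) (inj₁ v→w) (inj₂ u→w) = Succℕ⇒≢ u→w (functional v→u v→w)
  triangle (inj₂ v→u) (inj₂ w→v) (inj₁ w→u) = Succℕ⇒≢ v→u (functional w→v w→u)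

successor : (i : Fin n) → ∃ (Succ n i)
successor {suc n} i with suc (toℕ i) <? suc n
... | yes i+1<n = fromℕ< i+1<n , inj₁ (toℕ-fromℕ< i+1<n)
... | no  i+1≮n = Fin.zero , inj₂ (≤-antisym (toℕ<n i) (≮⇒≥ i+1≮n) , refl)

predecessor : (i : Fin n) → ∃ λ j → Succ n j i
predecessor {suc n} Fin.zero    = fromℕ n , inj₂ (cong suc (toℕ-fromℕ n) , refl)
predecessor         (Fin.suc i) = inject₁ i , inj₁ (cong suc (sym (toℕ-inject₁ i)))

Cycle-leafless : Leafless (Cycle (3 + k))
Cycle-leafless {b = b} (inj₁ b→w) with predecessor b
... | p , p→b = p , inj₂ p→b , λ { refl → Succℕ-asym b→w p→b }
Cycle-leafless {b = b} (inj₂ w→b) with successor b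
... | s , b→s = s , inj₁ b→s , λ { refl → Succℕ-asym w→b b→s }

BlueAt : Subset n → ℕ → Set
BlueAt {n} F m = ∀ v → toℕ v ≡ m → Blue (Cycle n) F v

module _ {F : Subset n} where

  ∈⇒BlueAt : ∀ {a} → a ∈ F → toℕ a ≡ m → BlueAt F m
  ∈⇒BlueAt a∈F a≡m v v≡m = initial (subst (_∈ F) (toℕ-injective (trans a≡m (sym v≡m))) a∈F)

  interior-neighbours : ∀ {b u : Fin n} → toℕ b ≡ suc j → suc (suc j) < n →
    Cycle n b u → toℕ u ≡ j ⊎ toℕ u ≡ suc (suc j)
  interior-neighbours b≡ _  (inj₁ (inj₁ u≡))        = inj₂ (trans u≡ (cong suc b≡))
  interior-neighbours b≡ lt (inj₁ (inj₂ (b+1≡n , _))) =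
    ⊥-elim (<-irrefl (trans (cong suc (sym b≡)) b+1≡n) lt)
  interior-neighbours b≡ _  (inj₂ (inj₁ b≡u+1))     = inj₁ (suc-injective (trans (sym b≡u+1) b≡))
  interior-neighbours b≡ _  (inj₂ (inj₂ (_ , b≡0)))  = ⊥-elim (0≢1+n (trans (sym b≡0) b≡))

  forward : BlueAt F j → BlueAt F (suc j) → BlueAt F (suc (suc j))
  forward {j} blue-j blue-j+1 w w≡ = force (blue-j+1 b b≡) b~w others
    where
    j+2<n = subst (_< n) w≡ (toℕ<n w)
    j+1<n = <-trans (n<1+n (suc j)) j+2<n
    b = fromℕ< j+1<n
    b≡ = toℕ-fromℕ< j+1<n
    b~w : Cycle n b w
    b~w = inj₁ (inj₁ (trans w≡ (cong suc (sym b≡))))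
    others : ∀ u → Cycle n b u → u ≢ w → Blue (Cycle n) F u
    others u b~u u≢w with interior-neighbours b≡ j+2<n b~u
    ... | inj₁ u≡j   = blue-j u u≡j
    ... | inj₂ u≡j+2 = contradiction (toℕ-injective (trans u≡j+2 (sym w≡))) u≢w

  backward : suc (suc j) < n → BlueAt F (suc j) → BlueAt F (suc (suc j)) → BlueAt F j
  backward {j} j+2<n blue-j+1 blue-j+2 w w≡ = force (blue-j+1 b b≡) b~w others
    where
    j+1<n = <-trans (n<1+n (suc j)) j+2<n
    b = fromℕ< j+1<n
    b≡ = toℕ-fromℕ< j+1<n
    b~w : Cycle n b w
    b~w = inj₂ (inj₁ (trans b≡ (cong suc (sym w≡))))
    others : ∀ u → Cycle n b u → u ≢ w → Blue (Cycle n) F u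
    others u b~u u≢w with interior-neighbours b≡ j+2<n b~u
    ... | inj₁ u≡j   = contradiction (toℕ-injective (trans u≡j (sym w≡))) u≢w
    ... | inj₂ u≡j+2 = blue-j+2 u u≡j+2

  spread-up : BlueAt F j → BlueAt F (suc j) → ∀ d → BlueAt F (d + j) × BlueAt F (suc (d + j))
  spread-up blue-j blue-j+1 zero = blue-j , blue-j+1
  spread-up blue-j blue-j+1 (suc d) with spread-up blue-j blue-j+1 d
  ... | blue-d+j , blue-d+j+1 = blue-d+j+1 , forward blue-d+j blue-d+j+1

  spread-down : ∀ d → suc (d + m) < n → BlueAt F (d + m) → BlueAt F (suc (d + m)) → BlueAt F m
  spread-down zero    _  blue-m _ = blue-m
  spread-down (suc d) lt blue-d+m+1 blue-d+m+2 =
    spread-down d (<-trans (n<1+n _) lt) (backward lt blue-d+m+1 blue-d+m+2) blue-d+m+1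

  consecutive⇒zfs : ∀ {a b} → toℕ b ≡ suc (toℕ a) → a ∈ F → b ∈ F → IsZeroForcingSet (Cycle n) F
  consecutive⇒zfs {a} {b} b≡a+1 a∈F b∈F v with toℕ a ≤? toℕ v
  ... | yes a≤v =
    proj₁ (spread-up (∈⇒BlueAt a∈F refl) (∈⇒BlueAt b∈F b≡a+1) (toℕ v ∸ toℕ a)) v (sym (m∸n+n≡m a≤v))
  ... | no  a≰v =
    spread-down (toℕ a ∸ toℕ v) (subst (_< n) b≡ (toℕ<n b)) (∈⇒BlueAt a∈F a≡) (∈⇒BlueAt b∈F b≡) v refl
    where
    a≡ = sym (m∸n+n≡m (<⇒≤ (≰⇒> a≰v)))
    b≡ = trans b≡a+1 (cong suc a≡)

B₀ : Subset (4 + k)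
B₀ = inside ∷ inside ∷ inside ∷ inside ∷ ∅

∣B₀∣≡4 : ∣ B₀ {k} ∣ ≡ 4
∣B₀∣≡4 {k} = cong (4 +_) (∣⊥∣≡0 k)

count-within-B₀ : ∀ c {f₀ f₁ f₂ f₃} {r : Subset k} →
  f₀ ∷ f₁ ∷ f₂ ∷ f₃ ∷ r ⊆ B₀ → c + ∣ r ∣ ≡ 3 → c ≡ 3
count-within-B₀ {k} c F⊆B₀ c+∣r∣≡3 = trans (sym (trans (cong (c +_) ∣r∣≡0) (+-identityʳ c))) c+∣r∣≡3
  where
  r⊆∅ = drop-∷-⊆ (drop-∷-⊆ (drop-∷-⊆ (drop-∷-⊆ F⊆B₀)))
  ∣r∣≡0 = n≤0⇒n≡0 (≤-trans (p⊆q⇒∣p∣≤∣q∣ r⊆∅) (≤-reflexive (∣⊥∣≡0 k)))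

three-of-B₀⇒zfs : (F : Subset (4 + k)) → F ⊆ B₀ → ∣ F ∣ ≡ 3 → IsZeroForcingSet (Cycle (4 + k)) F
three-of-B₀⇒zfs (inside ∷ inside ∷ _ ∷ _ ∷ _) _ _ = consecutive⇒zfs refl here (there here)
three-of-B₀⇒zfs (_ ∷ inside ∷ inside ∷ _ ∷ _) _ _ = consecutive⇒zfs refl (there here) (there (there here))
three-of-B₀⇒zfs (_ ∷ _ ∷ inside ∷ inside ∷ _) _ _ =
  consecutive⇒zfs refl (there (there here)) (there (there (there here)))
three-of-B₀⇒zfs (outside ∷ outside ∷ outside ∷ outside ∷ _) ⊆B₀ eq =
  contradiction (count-within-B₀ 0 ⊆B₀ eq) λ ()
three-of-B₀⇒zfs (inside  ∷ outside ∷ outside ∷ outside ∷ _) ⊆B₀ eq =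
  contradiction (count-within-B₀ 1 ⊆B₀ eq) λ ()
three-of-B₀⇒zfs (outside ∷ inside  ∷ outside ∷ outside ∷ _) ⊆B₀ eq =
  contradiction (count-within-B₀ 1 ⊆B₀ eq) λ ()
three-of-B₀⇒zfs (outside ∷ outside ∷ inside  ∷ outside ∷ _) ⊆B₀ eq =
  contradiction (count-within-B₀ 1 ⊆B₀ eq) λ ()
three-of-B₀⇒zfs (outside ∷ outside ∷ outside ∷ inside  ∷ _) ⊆B₀ eq =
  contradiction (count-within-B₀ 1 ⊆B₀ eq) λ ()
three-of-B₀⇒zfs (inside  ∷ outside ∷ inside  ∷ outside ∷ _) ⊆B₀ eq =
  contradiction (count-within-B₀ 2 ⊆B₀ eq) λ ()
three-of-B₀⇒zfs (outside ∷ inside  ∷ outside ∷ inside  ∷ _) ⊆B₀ eq =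
  contradiction (count-within-B₀ 2 ⊆B₀ eq) λ ()
three-of-B₀⇒zfs (inside  ∷ outside ∷ outside ∷ inside  ∷ _) ⊆B₀ eq =
  contradiction (count-within-B₀ 2 ⊆B₀ eq) λ ()

B₀-fault-tolerant : IsFaultTolerantZFS (Cycle (4 + k)) B₀
B₀-fault-tolerant {k} = s≤s z≤n , λ F F⊆B₀ ∣F∣≡∣B₀∣-1 →
  three-of-B₀⇒zfs F F⊆B₀ (trans ∣F∣≡∣B₀∣-1 (cong (_∸ 1) (∣B₀∣≡4 {k})))

fault-tolerant⇒4≤∣B∣ : ∀ {B} → IsFaultTolerantZFS (Cycle (4 + k)) B → 4 ≤ ∣ B ∣
fault-tolerant⇒4≤∣B∣ B-ft@(1≤∣B∣ , _) =
  edge-without-each⇒4≤∣B∣ Cycle-sym Cycle-triangle-free (1≤∣p∣⇒Nonempty 1≤∣B∣)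
    λ x∈B → zfs⇒HasEdgeIn Cycle-leafless {Fin.zero} {Fin.suc Fin.zero} (inj₁ (inj₁ refl))
              (fault-tolerant⇒zfs-without B-ft x∈B)

theorem3p3 : (n : ℕ) → 4 ≤ n → FaultTolerantZFNumberIs (Cycle n) 4
theorem3p3 (suc (suc (suc (suc k)))) (s≤s (s≤s (s≤s (s≤s z≤n)))) =
  (B₀ , B₀-fault-tolerant , ∣B₀∣≡4 {k}) , λ _ → fault-tolerant⇒4≤∣B∣
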